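{- Let $B$ be a board in the triangular grid or in the hexagonal grid. Then $d(B) = |B| - f(B)$, where $|B|$ is the number of cells of $B$.
   Context: The triangular grid is the tiling of the plane by congruent equilateral triangles (cells); the hexagonal grid is the tiling of the plane by congruent regular hexagons (cells). In either grid two cells are neighbors if they share an edge. A board is a finite set $B$ of cells such that every cell of $B$ has at least one neighbor in $B$ (no isolated cells). A domino (analogue) is a set of two neighboring cells. A domino covering of $B$ is a finite collection (repetitions allowed) of dominoes, each contained in $B$, whose union is $B$; it is saturated if removing any single domino leaves some cell of $B$ uncovered. $d(B)$ is the largest number of dominoes in a saturated domino covering of $B$. A fragment is a set of cells consisting of a cell $c$ together with a nonempty subset of the neighbors of $c$ in the grid. A fragment tiling of $B$ is a partition of $B$ into fragments, each contained in $B$; $f(B)$ is the minimum number of fragments in a fragment tiling of $B$. -}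

module Defs where

open import Data.Nat using (ℕ; _≤_; _∸_)
open import Data.Integer using (ℤ; _+_; _-_; +_; -_)
open import Data.Bool using (Bool; true; false)
open import Data.Product using (Σ; Σ-syntax; ∃; ∃-syntax; _×_; _,_; proj₁; proj₂)
open import Data.Sum using (_⊎_)
open import Data.Fin using (Fin)
open import Data.List using (List; []; _∷_; length; concat; removeAt)
open import Data.List.Membership.Propositional using (_∈_; _∉_)
open import Data.List.Relation.Unary.Any using (Any)
open import Data.List.Relation.Unary.Unique.Propositional using (Unique)
open import Data.List.Relation.Binary.Permutation.Propositional using (_↭_)
open import Relation.Binary.PropositionalEquality using (_≡_)

data GridKind : Set where
  triangular hexagonal : GridKind

-- Hexagonal grid: axial coordinates (q , r) ∈ ℤ².
-- Triangular grid: (x , y , up?) : the unit rhombus at (x , y) of the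
-- lattice ℤ·e₁ + ℤ·e₂ (e₁, e₂ at 60°) is split into an upward triangle
-- (true) and a downward triangle (false).
Cell : GridKind → Set
Cell triangular = ℤ × ℤ × Bool
Cell hexagonal  = ℤ × ℤ

one : ℤ
one = + 1

nbrs : (g : GridKind) → Cell g → List (Cell g)
nbrs hexagonal (q , r) =
  (q + one , r) ∷ (q - one , r) ∷ (q , r + one) ∷ (q , r - one)
  ∷ (q + one , r - one) ∷ (q - one , r + one) ∷ []
nbrs triangular (x , y , true)  =
  (x , y , false) ∷ (x - one , y , false) ∷ (x , y - one , false) ∷ []
nbrs triangular (x , y , false) =
  (x , y , true) ∷ (x + one , y , true) ∷ (x , y + one , true) ∷ []

Adj : (g : GridKind) → Cell g → Cell g → Set
Adj g c c' = c' ∈ nbrs g c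

Board : (g : GridKind) → List (Cell g) → Set
Board g B = Unique B × (∀ {c} → c ∈ B → Σ[ c' ∈ Cell g ] (c' ∈ B × Adj g c c'))

Domino : GridKind → Set
Domino g = Σ[ p ∈ Cell g × Cell g ] Adj g (proj₁ p) (proj₂ p)

Covered : {g : GridKind} → Cell g → List (Domino g) → Set
Covered c D = Any (λ d → c ≡ proj₁ (proj₁ d) ⊎ c ≡ proj₂ (proj₁ d)) D

-- A domino covering of B: a finite collection (repetitions allowed) of
-- dominoes contained in B whose union is B.
IsDominoCovering : (g : GridKind) → List (Cell g) → List (Domino g) → Set
IsDominoCovering g B D =
  (Data.List.Relation.Unary.All.All
     (λ d → proj₁ (proj₁ d) ∈ B × proj₂ (proj₁ d) ∈ B) D)
  × (∀ {c} → c ∈ B → Covered c D)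
  where import Data.List.Relation.Unary.All

IsSaturated : (g : GridKind) → List (Cell g) → List (Domino g) → Set
IsSaturated g B D =
  IsDominoCovering g B D
  × ((i : Fin (length D)) → Σ[ c ∈ Cell g ] (c ∈ B × (Covered c (removeAt D i) → Data.Empty.⊥)))
  where import Data.Empty

IsD : (g : GridKind) → List (Cell g) → ℕ → Set
IsD g B k =
  (Σ[ D ∈ List (Domino g) ] (IsSaturated g B D × length D ≡ k))
  × (∀ (D : List (Domino g)) → IsSaturated g B D → length D ≤ k)

-- A fragment (given as a duplicate-free list of its cells): a cell c together
-- with a nonempty set of neighbours of c.
IsFragment : (g : GridKind) → List (Cell g) → Set
IsFragment g F =
  Unique F
  × Σ[ c ∈ Cell g ] (c ∈ F × (∀ {x} → x ∈ F → x ≡ c ⊎ Adj g c x) × 2 ≤ length F)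

IsFragmentTiling : (g : GridKind) → List (Cell g) → List (List (Cell g)) → Set
IsFragmentTiling g B Fs =
  Data.List.Relation.Unary.All.All (IsFragment g) Fs × (concat Fs ↭ B)
  where import Data.List.Relation.Unary.All

IsF : (g : GridKind) → List (Cell g) → ℕ → Set
IsF g B m =
  (Σ[ Fs ∈ List (List (Cell g)) ] (IsFragmentTiling g B Fs × length Fs ≡ m))
  × (∀ (Fs : List (List (Cell g))) → IsFragmentTiling g B Fs → m ≤ length Fs)

-- Every domino of a saturated covering D has a private cell, covered by no other domino, for
-- otherwise it could be dropped.  Private cells of distinct dominoes differ and the other end of a
-- domino is never private, so each non-private cell together with the private cells of the
-- dominoes through it is a fragment, and these fragments tile B with |B| − |D| pieces.
-- Conversely the spokes (centre to leaf) of a tiling by k fragments form a saturated covering by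
-- |B| − k dominoes, each leaf being private to its spoke.  So the largest saturated covering and
-- the smallest tiling have sizes adding up to |B|; the largest exists because saturated coverings
-- have at most |B| dominoes and can be searched for among lists over the finitely many dominoes
-- in B.

module Submission where

open import Defs
open import Data.Nat using (ℕ; zero; suc; _+_; _∸_; _≤_; _<_; s≤s)
open import Data.Nat.Properties
  using (+-comm; m≤n+m; m+n∸m≡n; m+n∸n≡m; ∸-monoʳ-≤; ≤-pred; ≤∧≢⇒<; n≤0⇒n≡0; ≤-reflexive; module ≤-Reasoning)
open import Data.Nat.Induction using (<-wellFounded)
import Data.Integer as ℤ
open import Data.Integer using () renaming (_≟_ to _≟ℤ_)
open import Data.Integer.Properties using (+-0-abelianGroup; i≢suc[i]) renaming (+-comm to ℤ-+-comm)
open import Algebra.Properties.AbelianGroup +-0-abelianGroup using (//-rightDividesˡ; //-rightDividesʳ)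
open import Data.Bool using (true; false) renaming (_≟_ to _≟𝔹_)
open import Data.Fin using (Fin; zero; suc; cast)
import Data.Fin.Properties as Fin
open import Data.Product using (Σ-syntax; ∃; ∃-syntax; _×_; _,_; proj₁; proj₂)
open import Data.Product.Properties using (≡-dec)
open import Data.Sum using (_⊎_; inj₁; inj₂)
open import Data.Empty using (⊥-elim)
open import Function using (_∘_; id)
open import Function.Bundles using (mk⇔)
open import Induction.WellFounded using (Acc; acc)
open import Data.List
  using (List; []; _∷_; _++_; length; map; concat; concatMap; filter; lookup; cartesianProductWith; removeAt; allFin)
open import Data.List.Properties using (length-map; length-++; map-++; length-removeAt′; map-removeAt; length-tabulate)
open import Data.List.Relation.Unary.Any using (Any; here; there)
import Data.List.Relation.Unary.Any as Any
import Data.List.Relation.Unary.Any.Properties as Any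
open import Data.List.Relation.Unary.All using (All; []; _∷_)
import Data.List.Relation.Unary.All as All
import Data.List.Relation.Unary.All.Properties as All
open import Data.List.Relation.Unary.AllPairs using (AllPairs; []; _∷_)
import Data.List.Relation.Unary.AllPairs.Properties as AllPairs
open import Data.List.Relation.Unary.Unique.Propositional using (Unique)
import Data.List.Relation.Unary.Unique.Propositional.Properties as Unique
open import Data.List.Relation.Binary.Disjoint.Propositional using (Disjoint)
open import Data.List.Membership.Propositional using (_∈_; find; lose; mapWith∈)
open import Data.List.Membership.Propositional.Properties
open import Data.List.Membership.Propositional.Properties.WithK using (unique∧set⇒bag)
open import Data.List.Relation.Binary.BagAndSetEquality using (∼bag⇒↭)
open import Data.List.Relation.Binary.Permutation.Propositional
  using (_↭_; ↭-refl; ↭-sym; ↭-trans; ↭-prep; ↭⇒↭ₛ)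
import Data.List.Relation.Binary.Permutation.Propositional.Properties as ↭
open import Relation.Nullary using (¬_; Dec; yes; no; ¬?)
open import Relation.Nullary.Decidable using (_×-dec_; map′; toWitness; fromWitness)
open import Relation.Unary using (Decidable)
open import Relation.Binary.Definitions using (DecidableEquality)
open import Relation.Binary.PropositionalEquality
  using (_≡_; _≢_; refl; sym; trans; cong; cong₂; subst; setoid; module ≡-Reasoning)
import Data.List.Relation.Binary.Permutation.Setoid.Properties as Permutationₛ

cell-≟ : (g : GridKind) → DecidableEquality (Cell g)
cell-≟ triangular = ≡-dec _≟ℤ_ (≡-dec _≟ℤ_ _≟𝔹_)
cell-≟ hexagonal  = ≡-dec _≟ℤ_ _≟ℤ_

private
  i≡i+1-1 : ∀ q → q ≡ q ℤ.+ one ℤ.- one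
  i≡i+1-1 q = sym (//-rightDividesʳ one q)

  i≡i-1+1 : ∀ q → q ≡ q ℤ.- one ℤ.+ one
  i≡i-1+1 q = sym (//-rightDividesˡ one q)

  i+1≢i : ∀ q → q ℤ.+ one ≢ q
  i+1≢i q e = i≢suc[i] (sym (trans (ℤ-+-comm one q) e))

  i-1≢i : ∀ q → q ℤ.- one ≢ q
  i-1≢i q e = i+1≢i q (trans (cong (ℤ._+ one) (sym e)) (sym (i≡i-1+1 q)))

adj-sym : (g : GridKind) {a b : Cell g} → Adj g a b → Adj g b a
adj-sym hexagonal {q , r} (here refl) = there (here (cong₂ _,_ (i≡i+1-1 q) refl))
adj-sym hexagonal {q , r} (there (here refl)) = here (cong₂ _,_ (i≡i-1+1 q) refl)
adj-sym hexagonal {q , r} (there (there (here refl))) = there (there (there (here (cong₂ _,_ refl (i≡i+1-1 r)))))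
adj-sym hexagonal {q , r} (there (there (there (here refl)))) = there (there (here (cong₂ _,_ refl (i≡i-1+1 r))))
adj-sym hexagonal {q , r} (there (there (there (there (here refl))))) =
  there (there (there (there (there (here (cong₂ _,_ (i≡i+1-1 q) (i≡i-1+1 r)))))))
adj-sym hexagonal {q , r} (there (there (there (there (there (here refl)))))) =
  there (there (there (there (here (cong₂ _,_ (i≡i-1+1 q) (i≡i+1-1 r))))))
adj-sym triangular {x , y , true} (here refl) = here refl
adj-sym triangular {x , y , true} (there (here refl)) = there (here (cong (_, _) (i≡i-1+1 x)))
adj-sym triangular {x , y , true} (there (there (here refl))) = there (there (here (cong (λ z → x , z , true) (i≡i-1+1 y))))
adj-sym triangular {x , y , false} (here refl) = here refl
adj-sym triangular {x , y , false} (there (here refl)) = there (here (cong (_, _) (i≡i+1-1 x)))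
adj-sym triangular {x , y , false} (there (there (here refl))) = there (there (here (cong (λ z → x , z , false) (i≡i+1-1 y))))

adj-irrefl : (g : GridKind) {a : Cell g} → ¬ Adj g a a
adj-irrefl hexagonal {q , r} (here e) = i+1≢i q (sym (cong proj₁ e))
adj-irrefl hexagonal {q , r} (there (here e)) = i-1≢i q (sym (cong proj₁ e))
adj-irrefl hexagonal {q , r} (there (there (here e))) = i+1≢i r (sym (cong proj₂ e))
adj-irrefl hexagonal {q , r} (there (there (there (here e)))) = i-1≢i r (sym (cong proj₂ e))
adj-irrefl hexagonal {q , r} (there (there (there (there (here e))))) = i+1≢i q (sym (cong proj₁ e))
adj-irrefl hexagonal {q , r} (there (there (there (there (there (here e)))))) = i-1≢i q (sym (cong proj₁ e))
adj-irrefl triangular {x , y , true} (here ())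
adj-irrefl triangular {x , y , true} (there (here ()))
adj-irrefl triangular {x , y , true} (there (there (here ())))
adj-irrefl triangular {x , y , false} (here ())
adj-irrefl triangular {x , y , false} (there (here ()))
adj-irrefl triangular {x , y , false} (there (there (here ())))

module _ {a} {A : Set a} where

  Any-removeAt⁻ : ∀ {p} {P : A → Set p} xs i → Any P xs → P (lookup xs i) ⊎ Any P (removeAt xs i)
  Any-removeAt⁻ (x ∷ xs) zero    (here px)   = inj₁ px
  Any-removeAt⁻ (x ∷ xs) zero    (there pxs) = inj₂ pxs
  Any-removeAt⁻ (x ∷ xs) (suc i) (here px)   = inj₂ (here px)
  Any-removeAt⁻ (x ∷ xs) (suc i) (there pxs) = Data.Sum.map₂ there (Any-removeAt⁻ xs i pxs)

  Any-removeAt⁺ : ∀ {p} {P : A → Set p} xs {i j} → j ≢ i → P (lookup xs j) → Any P (removeAt xs i)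
  Any-removeAt⁺ (x ∷ xs) {zero}  {zero}  j≢i _  = ⊥-elim (j≢i refl)
  Any-removeAt⁺ (x ∷ xs) {zero}  {suc j} _   pj = lose (∈-lookup j) pj
  Any-removeAt⁺ (x ∷ xs) {suc i} {zero}  _   pj = here pj
  Any-removeAt⁺ (x ∷ xs) {suc i} {suc j} j≢i pj = there (Any-removeAt⁺ xs (j≢i ∘ cong suc) pj)

  All-removeAt : ∀ {p} {P : A → Set p} xs i → All P xs → All P (removeAt xs i)
  All-removeAt (x ∷ xs) zero    (px ∷ pxs) = pxs
  All-removeAt (x ∷ xs) (suc i) (px ∷ pxs) = px ∷ All-removeAt xs i pxs

  map-lookup∉removeAt : ∀ {b} {B : Set b} (f : A → B) xs → Unique (map f xs) →
                        ∀ i → ¬ Any (λ x → f (lookup xs i) ≡ f x) (removeAt xs i)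
  map-lookup∉removeAt f (x ∷ xs) (fx∉ ∷ _) zero    = All.All¬⇒¬Any fx∉ ∘ Any.map⁺
  map-lookup∉removeAt f (x ∷ xs) (fx∉ ∷ _) (suc i) (here e) =
    All.lookup fx∉ (∈-map⁺ f (∈-lookup i)) (sym e)
  map-lookup∉removeAt f (x ∷ xs) (_ ∷ u)   (suc i) (there p) = map-lookup∉removeAt f xs u i p

  AllPairs-++⁻ : ∀ {r} {R : A → A → Set r} xs {ys} → AllPairs R (xs ++ ys) →
                 AllPairs R xs × AllPairs R ys × All (λ x → All (R x) ys) xs
  AllPairs-++⁻ []       rs         = [] , rs , []
  AllPairs-++⁻ (x ∷ xs) (rx ∷ rxs) with AllPairs-++⁻ xs rxs
  ... | rs , rys , cross = All.++⁻ˡ xs rx ∷ rs , rys , All.++⁻ʳ xs rx ∷ cross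

  Unique-++⇒Disjoint : ∀ xs {ys} → Unique (xs ++ ys) → Disjoint xs ys
  Unique-++⇒Disjoint xs u (x∈xs , x∈ys) =
    All.lookup (All.lookup (proj₂ (proj₂ (AllPairs-++⁻ xs u))) x∈xs) x∈ys refl

  Unique-concat⁻ : ∀ xss → Unique (concat xss) → All Unique xss
  Unique-concat⁻ []         _ = []
  Unique-concat⁻ (xs ∷ xss) u with AllPairs-++⁻ xs u
  ... | uxs , uxss , _ = uxs ∷ Unique-concat⁻ xss uxss

  Unique-resp-↭ : ∀ {xs ys : List A} → xs ↭ ys → Unique xs → Unique ys
  Unique-resp-↭ p = Permutationₛ.Unique-resp-↭ (setoid A) (↭⇒↭ₛ p)

  Unique∧sameElements⇒↭ : ∀ {xs ys : List A} → Unique xs → Unique ys →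
                          (∀ {x} → x ∈ xs → x ∈ ys) → (∀ {x} → x ∈ ys → x ∈ xs) → xs ↭ ys
  Unique∧sameElements⇒↭ uxs uys to from = ∼bag⇒↭ (unique∧set⇒bag uxs uys (mk⇔ to from))

  AllPairs-restrict : ∀ {p r s} {P : A → Set p} {R : A → A → Set r} {S : A → A → Set s} →
                      (∀ {x y} → P x → P y → R x y → S x y) →
                      ∀ {xs} → All P xs → AllPairs R xs → AllPairs S xs
  AllPairs-restrict f []         []         = []
  AllPairs-restrict f (px ∷ pxs) (rx ∷ rxs) =
    All.zipWith (λ (py , r) → f px py r) (pxs , rx) ∷ AllPairs-restrict f pxs rxs

  listsOver : List A → ℕ → List (List A)
  listsOver xs zero    = [] ∷ []
  listsOver xs (suc k) = cartesianProductWith _∷_ xs (listsOver xs k)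

  ∈-listsOver⁺ : ∀ {xs ys} → All (_∈ xs) ys → ys ∈ listsOver xs (length ys)
  ∈-listsOver⁺ []         = here refl
  ∈-listsOver⁺ (y∈ ∷ ys∈) = ∈-cartesianProductWith⁺ _∷_ y∈ (∈-listsOver⁺ ys∈)

  ∈-listsOver⁻ : ∀ xs k {ys} → ys ∈ listsOver xs k → length ys ≡ k
  ∈-listsOver⁻ xs zero    (here refl) = refl
  ∈-listsOver⁻ xs (suc k) ys∈ with ∈-cartesianProductWith⁻ _∷_ xs (listsOver xs k) ys∈
  ... | _ , zs , _ , zs∈ , refl = cong suc (∈-listsOver⁻ xs k zs∈)

greatest-satisfying : ∀ {p} {P : ℕ → Set p} → Decidable P → ∀ n → (∀ {m} → P m → m ≤ n) →
                      ∃ P → ∃[ m ] (P m × ∀ {m′} → P m′ → m′ ≤ m)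
greatest-satisfying P? n bounded witness with P? n
... | yes pn = n , pn , bounded
greatest-satisfying {P = P} P? zero bounded (k , pk) | no ¬pn =
  ⊥-elim (¬pn (subst P (n≤0⇒n≡0 (bounded pk)) pk))
greatest-satisfying {P = P} P? (suc n) bounded witness | no ¬pn =
  greatest-satisfying P? n bounded′ witness
  where
  bounded′ : ∀ {m} → P m → m ≤ n
  bounded′ pm = ≤-pred (≤∧≢⇒< (bounded pm) λ { refl → ¬pn pm })

module Dominoes (g : GridKind) where

  private
    V : Set
    V = Cell g

  _≟_ : DecidableEquality V
  _≟_ = cell-≟ g

  open import Data.List.Membership.DecPropositional _≟_ using (_∈?_)

  first second : Domino g → V
  first  = proj₁ ∘ proj₁
  second = proj₂ ∘ proj₁

  Ends : V → Domino g → Set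
  Ends x d = x ≡ first d ⊎ x ≡ second d

  ends? : ∀ x d → Dec (Ends x d)
  ends? x d with x ≟ first d | x ≟ second d
  ... | yes x≡a | _       = yes (inj₁ x≡a)
  ... | no  _   | yes x≡b = yes (inj₂ x≡b)
  ... | no  x≢a | no  x≢b = no λ { (inj₁ x≡a) → x≢a x≡a ; (inj₂ x≡b) → x≢b x≡b }

  covered? : ∀ x D → Dec (Covered {g} x D)
  covered? x = Any.any? (ends? x)

  other : ∀ d {x} → Ends x d → V
  other d (inj₁ _) = second d
  other d (inj₂ _) = first d

  other-ends : ∀ d {x} (e : Ends x d) → Ends (other d e) d
  other-ends d (inj₁ _) = inj₂ refl
  other-ends d (inj₂ _) = inj₁ refl

  other-adj : ∀ d {x} (e : Ends x d) → Adj g (other d e) x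
  other-adj d (inj₁ refl) = adj-sym g (proj₂ d)
  other-adj d (inj₂ refl) = proj₂ d

  ends-other : ∀ d {x y} (e : Ends x d) → Ends y d → y ≡ x ⊎ y ≡ other d e
  ends-other d (inj₁ refl) (inj₁ refl) = inj₁ refl
  ends-other d (inj₁ refl) (inj₂ refl) = inj₂ refl
  ends-other d (inj₂ refl) (inj₁ refl) = inj₂ refl
  ends-other d (inj₂ refl) (inj₂ refl) = inj₁ refl

  -- Fragments as stars

  -- A fragment, given by its centre and the list of its leaves.
  Star : Set
  Star = V × List V

  IsStar : Star → Set
  IsStar (c , L) = 0 < length L × All (Adj g c) L

  starCells : Star → List V
  starCells (c , L) = c ∷ L

  cells leaves : List Star → List V
  cells  = concatMap starCells
  leaves = concatMap proj₂

  centres : List Star → List V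
  centres = map proj₁

  cells↭centres++leaves : ∀ Ss → cells Ss ↭ centres Ss ++ leaves Ss
  cells↭centres++leaves []             = ↭-refl
  cells↭centres++leaves ((c , L) ∷ Ss) =
    ↭-prep c (↭-trans (↭.++⁺ˡ L (cells↭centres++leaves Ss)) (↭.shifts L (centres Ss)))

  length-cells : ∀ Ss → length (cells Ss) ≡ length Ss + length (leaves Ss)
  length-cells Ss = begin
    length (cells Ss)                         ≡⟨ ↭.↭-length (cells↭centres++leaves Ss) ⟩
    length (centres Ss ++ leaves Ss)          ≡⟨ length-++ (centres Ss) ⟩
    length (centres Ss) + length (leaves Ss)  ≡⟨ cong (_+ length (leaves Ss)) (length-map proj₁ Ss) ⟩
    length Ss + length (leaves Ss)            ∎
    where open ≡-Reasoning

  StarPartition : List V → List Star → Set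
  StarPartition B Ss = All IsStar Ss × cells Ss ↭ B

  fragment⇒star : ∀ {F} → IsFragment g F → Σ[ s ∈ Star ] (IsStar s × starCells s ↭ F)
  fragment⇒star (uF , c , c∈F , spoke , 2≤|F|) with ∈-∃++ c∈F
  ... | h , t , refl = (c , h ++ t) , (nonempty , All.tabulate adj) , c∷h++t↭F
    where
    c∷h++t↭F : c ∷ h ++ t ↭ h ++ c ∷ t
    c∷h++t↭F = ↭-sym (↭.shift c h t)
    nonempty : 0 < length (h ++ t)
    nonempty = ≤-pred (subst (2 ≤_) (sym (↭.↭-length c∷h++t↭F)) 2≤|F|)
    adj : ∀ {y} → y ∈ h ++ t → Adj g c y
    adj {y} y∈ with spoke (↭.∈-resp-↭ c∷h++t↭F (there y∈))
    ... | inj₁ refl = ⊥-elim (Unique.Unique[x∷xs]⇒x∉xs (Unique-resp-↭ (↭-sym c∷h++t↭F) uF) y∈)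
    ... | inj₂ c~y  = c~y

  fragments⇒stars : ∀ {Fs} → All (IsFragment g) Fs →
                    Σ[ Ss ∈ List Star ] (All IsStar Ss × cells Ss ↭ concat Fs × length Ss ≡ length Fs)
  fragments⇒stars []           = [] , [] , ↭-refl , refl
  fragments⇒stars (isF ∷ isFs) with fragment⇒star isF | fragments⇒stars isFs
  ... | s , isS , s↭F | Ss , isSs , Ss↭Fs , |Ss| = s ∷ Ss , isS ∷ isSs , ↭.++⁺ s↭F Ss↭Fs , cong suc |Ss|

  star⇒fragment : ∀ {s} → IsStar s → Unique (starCells s) → IsFragment g (starCells s)
  star⇒fragment {c , L} (nonempty , adjacent) u = u , c , here refl , spoke , s≤s nonempty
    where
    spoke : ∀ {x} → x ∈ c ∷ L → x ≡ c ⊎ Adj g c x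
    spoke (here x≡c) = inj₁ x≡c
    spoke (there x∈L) = inj₂ (All.lookup adjacent x∈L)

  starPartition⇒tiling : ∀ {B Ss} → Unique B → StarPartition B Ss → IsFragmentTiling g B (map starCells Ss)
  starPartition⇒tiling {B} {Ss} uB (isStars , Ss↭B) =
    All.map⁺ (All.zipWith fragment (isStars , uniqueStars)) , Ss↭B
    where
    fragment : ∀ {s} → IsStar s × Unique (starCells s) → IsFragment g (starCells s)
    fragment (isS , u) = star⇒fragment isS u
    uniqueStars : All (Unique ∘ starCells) Ss
    uniqueStars = All.map⁻ (Unique-concat⁻ (map starCells Ss) (Unique-resp-↭ (↭-sym Ss↭B) uB))

  -- From a fragment tiling to a saturated covering

  spokes : ∀ c L → All (Adj g c) L → List (Domino g)
  spokes c []      []       = []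
  spokes c (l ∷ L) (a ∷ as) = ((c , l) , a) ∷ spokes c L as

  starDominoes : ∀ Ss → All IsStar Ss → List (Domino g)
  starDominoes []             []                = []
  starDominoes ((c , L) ∷ Ss) ((_ , as) ∷ isSs) = spokes c L as ++ starDominoes Ss isSs

  map-second-starDominoes : ∀ Ss isSs → map second (starDominoes Ss isSs) ≡ leaves Ss
  map-second-starDominoes []             []                = refl
  map-second-starDominoes ((c , L) ∷ Ss) ((_ , as) ∷ isSs) = begin
    map second (spokes c L as ++ starDominoes Ss isSs)
      ≡⟨ map-++ second (spokes c L as) _ ⟩
    map second (spokes c L as) ++ map second (starDominoes Ss isSs)
      ≡⟨ cong₂ _++_ (seconds L as) (map-second-starDominoes Ss isSs) ⟩
    L ++ leaves Ss
      ∎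
    where
    open ≡-Reasoning
    seconds : ∀ L as → map second (spokes c L as) ≡ L
    seconds []      []       = refl
    seconds (l ∷ L) (a ∷ as) = cong (l ∷_) (seconds L as)

  length-starDominoes : ∀ Ss isSs → length (starDominoes Ss isSs) ≡ length (leaves Ss)
  length-starDominoes Ss isSs =
    trans (sym (length-map second (starDominoes Ss isSs))) (cong length (map-second-starDominoes Ss isSs))

  first-starDominoes : ∀ Ss isSs → All (λ d → first d ∈ centres Ss) (starDominoes Ss isSs)
  first-starDominoes []             []                = []
  first-starDominoes ((c , L) ∷ Ss) ((_ , as) ∷ isSs) =
    All.++⁺ (firsts L as) (All.map there (first-starDominoes Ss isSs))
    where
    firsts : ∀ L as → All (λ d → first d ∈ c ∷ centres Ss) (spokes c L as)
    firsts []      []       = []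
    firsts (l ∷ L) (a ∷ as) = here refl ∷ firsts L as

  spokes-cover : ∀ c L as {x} → x ∈ L → Covered {g} x (spokes c L as)
  spokes-cover c (l ∷ L) (a ∷ as) (here x≡l)  = here (inj₂ x≡l)
  spokes-cover c (l ∷ L) (a ∷ as) (there x∈L) = there (spokes-cover c L as x∈L)

  starDominoes-cover : ∀ Ss isSs {x} → x ∈ cells Ss → Covered {g} x (starDominoes Ss isSs)
  starDominoes-cover ((c , l ∷ L) ∷ Ss) ((_ , a ∷ as) ∷ isSs) (here x≡c) = here (inj₁ x≡c)
  starDominoes-cover ((c , L) ∷ Ss) ((_ , as) ∷ isSs) (there x∈) with ∈-++⁻ L x∈
  ... | inj₁ x∈L  = Any.++⁺ˡ (spokes-cover c L as x∈L)
  ... | inj₂ x∈Ss = Any.++⁺ʳ (spokes c L as) (starDominoes-cover Ss isSs x∈Ss)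

  starPartition⇒saturated : ∀ {B Ss} → Unique B → StarPartition B Ss →
                            Σ[ D ∈ List (Domino g) ] (IsSaturated g B D × length D + length Ss ≡ length B)
  starPartition⇒saturated {B} {Ss} uB (isSs , Ss↭B) = D , ((ends , cover) , private-leaf) , size
    where
    D : List (Domino g)
    D = starDominoes Ss isSs
    cs↭B : centres Ss ++ leaves Ss ↭ B
    cs↭B = ↭-trans (↭-sym (cells↭centres++leaves Ss)) Ss↭B
    unique-cs : Unique (centres Ss ++ leaves Ss)
    unique-cs = Unique-resp-↭ (↭-sym cs↭B) uB
    unique-seconds : Unique (map second D)
    unique-seconds = subst Unique (sym (map-second-starDominoes Ss isSs))
                       (proj₁ (proj₂ (AllPairs-++⁻ (centres Ss) unique-cs)))
    second∈leaves : ∀ {d} → d ∈ D → second d ∈ leaves Ss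
    second∈leaves d∈ = subst (_ ∈_) (map-second-starDominoes Ss isSs) (∈-map⁺ second d∈)
    ends : All (λ d → first d ∈ B × second d ∈ B) D
    ends = All.tabulate λ d∈ → ↭.∈-resp-↭ cs↭B (∈-++⁺ˡ (All.lookup (first-starDominoes Ss isSs) d∈))
                             , ↭.∈-resp-↭ cs↭B (∈-++⁺ʳ (centres Ss) (second∈leaves d∈))
    cover : ∀ {x} → x ∈ B → Covered {g} x D
    cover x∈B = starDominoes-cover Ss isSs (↭.∈-resp-↭ (↭-sym Ss↭B) x∈B)
    private-leaf : (i : Fin (length D)) → Σ[ x ∈ V ] (x ∈ B × ¬ Covered {g} x (removeAt D i))
    private-leaf i = second (lookup D i) , proj₂ (All.lookup ends (∈-lookup i)) , uncovered
      where
      uncovered : ¬ Covered {g} (second (lookup D i)) (removeAt D i)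
      uncovered cov with Any.Any-⊎⁻ cov
      ... | inj₂ as-second = map-lookup∉removeAt second D unique-seconds i as-second
      ... | inj₁ as-first with find as-first
      ...   | d , d∈ , refl = Unique-++⇒Disjoint (centres Ss) unique-cs
                (All.lookup (All-removeAt D i (first-starDominoes Ss isSs)) d∈ , second∈leaves (∈-lookup i))
    size : length D + length Ss ≡ length B
    size = begin
      length D + length Ss                     ≡⟨ cong (_+ length Ss) (length-starDominoes Ss isSs) ⟩
      length (leaves Ss) + length Ss           ≡⟨ +-comm (length (leaves Ss)) (length Ss) ⟩
      length Ss + length (leaves Ss)           ≡⟨ sym (length-cells Ss) ⟩
      length (cells Ss)                        ≡⟨ ↭.↭-length Ss↭B ⟩
      length B                                 ∎
      where open ≡-Reasoning

  -- From a saturated covering to a fragment tiling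

  module PrivateCells {B : List V} (uB : Unique B) {D : List (Domino g)} (sat : IsSaturated g B D) where

    private
      n : ℕ
      n = length D

      dom : Fin n → Domino g
      dom = lookup D

      covers : ∀ {c} → c ∈ B → Covered {g} c D
      covers = proj₂ (proj₁ sat)

    private-cell : Fin n → V
    private-cell i = proj₁ (proj₂ sat i)

    private∈B : ∀ i → private-cell i ∈ B
    private∈B i = proj₁ (proj₂ (proj₂ sat i))

    private-uncovered : ∀ i → ¬ Covered {g} (private-cell i) (removeAt D i)
    private-uncovered i = proj₂ (proj₂ (proj₂ sat i))

    private-cell-ends : ∀ i → Ends (private-cell i) (dom i)
    private-cell-ends i with Any-removeAt⁻ D i (covers (private∈B i))
    ... | inj₁ ends      = ends
    ... | inj₂ elsewhere = ⊥-elim (private-uncovered i elsewhere)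

    ends-private-cell⇒≡ : ∀ {i j} → Ends (private-cell i) (dom j) → j ≡ i
    ends-private-cell⇒≡ {i} {j} ends with j Fin.≟ i
    ... | yes j≡i = j≡i
    ... | no  j≢i = ⊥-elim (private-uncovered i (Any-removeAt⁺ D j≢i ends))

    private-injective : ∀ {i j} → private-cell i ≡ private-cell j → i ≡ j
    private-injective {i} e = ends-private-cell⇒≡ (subst (λ x → Ends x (dom i)) e (private-cell-ends i))

    partner : Fin n → V
    partner i = other (dom i) (private-cell-ends i)

    partner-adj : ∀ i → Adj g (partner i) (private-cell i)
    partner-adj i = other-adj (dom i) (private-cell-ends i)

    partner∈B : ∀ i → partner i ∈ B
    partner∈B i with other-ends (dom i) (private-cell-ends i) | All.lookup (proj₁ (proj₁ sat)) (∈-lookup i)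
    ... | inj₁ e | a∈B , _ = subst (_∈ B) (sym e) a∈B
    ... | inj₂ e | _ , b∈B = subst (_∈ B) (sym e) b∈B

    partner≢private : ∀ i j → partner i ≢ private-cell j
    partner≢private i j e
      with ends-private-cell⇒≡ {j} {i} (subst (λ x → Ends x (dom i)) e (other-ends (dom i) (private-cell-ends i)))
    ... | refl = adj-irrefl g (subst (λ x → Adj g x (private-cell i)) e (partner-adj i))

    IsPrivate : V → Set
    IsPrivate x = ∃[ i ] private-cell i ≡ x

    isPrivate? : Decidable IsPrivate
    isPrivate? x = Fin.any? λ i → private-cell i ≟ x

    centreCells : List V
    centreCells = filter (¬? ∘ isPrivate?) B

    leavesAt : V → List V
    leavesAt c = map private-cell (filter (λ i → partner i ≟ c) (allFin n))

    ∈-leavesAt⁺ : ∀ {i c} → partner i ≡ c → private-cell i ∈ leavesAt c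
    ∈-leavesAt⁺ {i} e = ∈-map∘filter⁺ private-cell (λ i → partner i ≟ _) (i , ∈-allFin i , refl , e)

    ∈-leavesAt⁻ : ∀ {x c} → x ∈ leavesAt c → ∃[ i ] (partner i ≡ c × x ≡ private-cell i)
    ∈-leavesAt⁻ x∈ with ∈-map∘filter⁻ private-cell (λ i → partner i ≟ _) {xs = allFin n} x∈
    ... | i , _ , x≡ , e = i , e , x≡

    centre-partner : ∀ {c} → c ∈ B → ¬ IsPrivate c → ∃[ i ] partner i ≡ c
    centre-partner c∈B ¬private
      with ends-other (dom (Any.index (covers c∈B))) (private-cell-ends _) (Any.lookup-index (covers c∈B))
    ... | inj₁ c≡private = ⊥-elim (¬private (_ , sym c≡private))
    ... | inj₂ c≡partner = _ , sym c≡partner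

    centreStar : V → Star
    centreStar c = c , leavesAt c

    stars : List Star
    stars = map centreStar centreCells

    ∈-centreCells⁻ : ∀ {c} → c ∈ centreCells → c ∈ B × ¬ IsPrivate c
    ∈-centreCells⁻ = ∈-filter⁻ (¬? ∘ isPrivate?)

    centreStar-isStar : ∀ {c} → c ∈ B → ¬ IsPrivate c → IsStar (centreStar c)
    centreStar-isStar c∈B ¬private =
      ∈-length (∈-leavesAt⁺ (proj₂ (centre-partner c∈B ¬private))) , All.tabulate spoke
      where
      spoke : ∀ {x} → x ∈ leavesAt _ → Adj g _ x
      spoke x∈ with ∈-leavesAt⁻ x∈
      ... | i , refl , refl = partner-adj i

    leaf-private : ∀ {c x} → x ∈ leavesAt c → IsPrivate x
    leaf-private x∈ with ∈-leavesAt⁻ x∈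
    ... | i , _ , x≡ = i , sym x≡

    centreStar-unique : ∀ {c} → ¬ IsPrivate c → Unique (starCells (centreStar c))
    centreStar-unique ¬private =
      All.tabulate (λ x∈ c≡x → ¬private (subst IsPrivate (sym c≡x) (leaf-private x∈)))
      ∷ Unique.map⁺ private-injective (Unique.filter⁺ _ (Unique.allFin⁺ n))

    centreStars-disjoint : ∀ {c c′} → ¬ IsPrivate c → ¬ IsPrivate c′ → c ≢ c′ →
                           Disjoint (starCells (centreStar c)) (starCells (centreStar c′))
    centreStars-disjoint _        _         c≢c′ (here refl , here refl) = c≢c′ refl
    centreStars-disjoint ¬private _         _    (here refl , there x∈) = ¬private (leaf-private x∈)
    centreStars-disjoint _        ¬private′ _    (there x∈ , here refl) = ¬private′ (leaf-private x∈)
    centreStars-disjoint _        _         c≢c′ (there x∈ , there x∈′)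
      with ∈-leavesAt⁻ x∈ | ∈-leavesAt⁻ x∈′
    ... | i , refl , refl | j , refl , e with private-injective e
    ... | refl = c≢c′ refl

    unique-cells : Unique (cells stars)
    unique-cells = Unique.concat⁺
      (All.map⁺ (All.map⁺ (All.tabulate (centreStar-unique ∘ proj₂ ∘ ∈-centreCells⁻))))
      (AllPairs.map⁺ (AllPairs.map⁺ (AllPairs-restrict centreStars-disjoint
        (All.all-filter (¬? ∘ isPrivate?) B) (Unique.filter⁺ _ uB))))

    cells↭B : cells stars ↭ B
    cells↭B = Unique∧sameElements⇒↭ unique-cells uB to from
      where
      to : ∀ {x} → x ∈ cells stars → x ∈ B
      to x∈ with find (Any.map⁻ {f = centreStar} (∈-concatMap⁻ starCells x∈))
      ... | c , c∈ , here refl = proj₁ (∈-centreCells⁻ c∈)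
      ... | c , c∈ , there x∈L with ∈-leavesAt⁻ x∈L
      ...   | i , _ , refl = private∈B i
      in-star : ∀ {x c} → c ∈ centreCells → x ∈ starCells (centreStar c) → x ∈ cells stars
      in-star c∈ x∈ = ∈-concatMap⁺ starCells (Any.map⁺ (lose c∈ x∈))
      from : ∀ {x} → x ∈ B → x ∈ cells stars
      from {x} x∈B with isPrivate? x
      ... | yes (i , refl) = in-star (∈-filter⁺ (¬? ∘ isPrivate?) (partner∈B i) partner-centre)
                                     (there (∈-leavesAt⁺ refl))
        where
        partner-centre : ¬ IsPrivate (partner i)
        partner-centre (j , e) = partner≢private i j (sym e)
      ... | no ¬private = in-star (∈-filter⁺ (¬? ∘ isPrivate?) x∈B ¬private) (here refl)

    B↭centres++privates : B ↭ centreCells ++ map private-cell (allFin n)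
    B↭centres++privates = Unique∧sameElements⇒↭ uB
      (Unique.++⁺ (Unique.filter⁺ _ uB) (Unique.map⁺ private-injective (Unique.allFin⁺ n)) disjoint)
      to from
      where
      disjoint : Disjoint centreCells (map private-cell (allFin n))
      disjoint (x∈C , x∈P) with ∈-map⁻ private-cell x∈P
      ... | i , _ , refl = proj₂ (∈-centreCells⁻ x∈C) (i , refl)
      to : ∀ {x} → x ∈ B → x ∈ centreCells ++ map private-cell (allFin n)
      to {x} x∈B with isPrivate? x
      ... | yes (i , refl) = ∈-++⁺ʳ centreCells (∈-map⁺ private-cell (∈-allFin i))
      ... | no ¬private    = ∈-++⁺ˡ (∈-filter⁺ (¬? ∘ isPrivate?) x∈B ¬private)
      from : ∀ {x} → x ∈ centreCells ++ map private-cell (allFin n) → x ∈ B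
      from x∈ with ∈-++⁻ centreCells x∈
      ... | inj₁ x∈C = proj₁ (∈-centreCells⁻ x∈C)
      ... | inj₂ x∈P with ∈-map⁻ private-cell x∈P
      ...   | i , _ , refl = private∈B i

    size : length stars + n ≡ length B
    size = begin
      length stars + n
        ≡⟨ cong₂ _+_ (length-map centreStar centreCells) (sym (length-tabulate id)) ⟩
      length centreCells + length (allFin n)
        ≡⟨ cong (length centreCells +_) (sym (length-map private-cell (allFin n))) ⟩
      length centreCells + length (map private-cell (allFin n))
        ≡⟨ sym (length-++ centreCells) ⟩
      length (centreCells ++ map private-cell (allFin n))
        ≡⟨ ↭.↭-length (↭-sym B↭centres++privates) ⟩
      length B
        ∎
      where open ≡-Reasoning

  saturated⇒starPartition : ∀ {B D} → Unique B → IsSaturated g B D →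
                            Σ[ Ss ∈ List Star ] (StarPartition B Ss × length Ss + length D ≡ length B)
  saturated⇒starPartition uB sat = stars , (All.map⁺ (All.tabulate isStar) , cells↭B) , size
    where
    open PrivateCells uB sat
    isStar : ∀ {c} → c ∈ centreCells → IsStar (centreStar c)
    isStar c∈ = let c∈B , ¬private = ∈-centreCells⁻ c∈ in centreStar-isStar c∈B ¬private

  saturated⇒tiling : ∀ {B D} → Unique B → IsSaturated g B D →
                     Σ[ Fs ∈ List (List V) ] (IsFragmentTiling g B Fs × length Fs + length D ≡ length B)
  saturated⇒tiling {D = D} uB sat with saturated⇒starPartition uB sat
  ... | Ss , partition , size =
    map starCells Ss , starPartition⇒tiling uB partition ,
    trans (cong (_+ length D) (length-map starCells Ss)) size

  tiling⇒saturated : ∀ {B Fs} → Unique B → IsFragmentTiling g B Fs →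
                     Σ[ D ∈ List (Domino g) ] (IsSaturated g B D × length D + length Fs ≡ length B)
  tiling⇒saturated uB (fragments , Fs↭B) with fragments⇒stars fragments
  ... | Ss , isSs , Ss↭Fs , |Ss| with starPartition⇒saturated uB (isSs , ↭-trans Ss↭Fs Fs↭B)
  ...   | D , sat , size = D , sat , trans (cong (length D +_) (sym |Ss|)) size

  -- A largest saturated covering

  privateCell? : ∀ B D i → Dec (Σ[ c ∈ V ] (c ∈ B × ¬ Covered {g} c (removeAt D i)))
  privateCell? B D i = map′ find (λ (c , c∈B , ¬cov) → lose c∈B ¬cov)
                         (Any.any? (λ c → ¬? (covered? c (removeAt D i))) B)

  covering? : ∀ B D → Dec (IsDominoCovering g B D)
  covering? B D = All.all? (λ d → first d ∈? B ×-dec second d ∈? B) D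
           ×-dec map′ All.lookup All.tabulate (All.all? (λ c → covered? c D) B)

  saturated? : ∀ B D → Dec (IsSaturated g B D)
  saturated? B D = covering? B D ×-dec Fin.all? (privateCell? B D)

  neighbourCovering : ∀ {B} → (∀ {c} → c ∈ B → Σ[ c′ ∈ V ] (c′ ∈ B × Adj g c c′)) →
                      ∃ (IsDominoCovering g B)
  neighbourCovering {B} neighbour = D , All.tabulate ends , cover
    where
    D : List (Domino g)
    D = mapWith∈ B λ {c} c∈B → (c , proj₁ (neighbour c∈B)) , proj₂ (proj₂ (neighbour c∈B))
    ends : ∀ {d} → d ∈ D → first d ∈ B × second d ∈ B
    ends d∈ with Any.mapWith∈⁻ B _ d∈
    ... | _ , c∈B , refl = c∈B , proj₁ (proj₂ (neighbour c∈B))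
    cover : ∀ {c} → c ∈ B → Covered {g} c D
    cover c∈B = Any.mapWith∈⁺ _ (_ , c∈B , inj₁ refl)

  saturate : ∀ {B} D → Acc _<_ (length D) → IsDominoCovering g B D → ∃ (IsSaturated g B)
  saturate {B} D (acc smaller) covering with Fin.all? (privateCell? B D)
  ... | yes privateCells = D , covering , privateCells
  ... | no ¬privateCells with Fin.¬∀⟶∃¬ _ _ (privateCell? B D) ¬privateCells
  ...   | i , redundant =
    saturate (removeAt D i) (smaller (≤-reflexive (sym (length-removeAt′ D i))))
             (All-removeAt D i (proj₁ covering) , still-covered)
    where
    still-covered : ∀ {c} → c ∈ B → Covered {g} c (removeAt D i)
    still-covered {c} c∈B with covered? c (removeAt D i)
    ... | yes cov = cov
    ... | no ¬cov = ⊥-elim (redundant (c , c∈B , ¬cov))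

  -- Adjacency proofs are not unique; replacing them by the one found by _∈?_ makes the saturated
  -- coverings of a given size range over a finite list.
  canonical : Domino g → Domino g
  canonical d = proj₁ d , toWitness (fromWitness {a? = second d ∈? nbrs g (first d)} (proj₂ d))

  dominoBetween : ∀ a b → Dec (Adj g a b) → List (Domino g)
  dominoBetween a b (yes a~b) = ((a , b) , a~b) ∷ []
  dominoBetween a b (no _)    = []

  ∈-dominoBetween : ∀ {a b} (a~b? : Dec (Adj g a b)) (a~b : Adj g a b) →
                    ((a , b) , toWitness (fromWitness {a? = a~b?} a~b)) ∈ dominoBetween a b a~b?
  ∈-dominoBetween (yes _)   _   = here refl
  ∈-dominoBetween (no ¬a~b) a~b = ⊥-elim (¬a~b a~b)

  dominoesIn : List V → List (Domino g)
  dominoesIn B = concatMap (λ a → concatMap (λ b → dominoBetween a b (b ∈? nbrs g a)) B) B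

  ∈-dominoesIn : ∀ {B} d → first d ∈ B → second d ∈ B → canonical d ∈ dominoesIn B
  ∈-dominoesIn d a∈B b∈B =
    ∈-concatMap⁺ _ (lose a∈B (∈-concatMap⁺ _ (lose b∈B (∈-dominoBetween _ (proj₂ d)))))

  canonical-saturated : ∀ {B D} → IsSaturated g B D → IsSaturated g B (map canonical D)
  canonical-saturated {B} {D} ((ends , cover) , privateCells) =
    (All.map⁺ ends , Any.map⁺ ∘ cover) , privateCells′
    where
    privateCells′ : (i : Fin (length (map canonical D))) →
                    Σ[ c ∈ V ] (c ∈ B × ¬ Covered {g} c (removeAt (map canonical D) i))
    privateCells′ i with privateCells (cast (length-map canonical D) i)
    ... | c , c∈B , ¬cov = c , c∈B , ¬cov ∘ Any.map⁻ ∘ subst (Covered c) removeAt-map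
      where
      |map| : length (map canonical D) ≡ length D
      |map| = length-map canonical D
      removeAt-map : removeAt (map canonical D) i ≡ map canonical (removeAt D (cast |map| i))
      removeAt-map = trans (cong (removeAt (map canonical D)) (sym (Fin.cast-involutive (sym |map|) |map| i)))
                           (sym (map-removeAt D _ canonical))

  SaturatedOfSize : List V → ℕ → Set
  SaturatedOfSize B k = Σ[ D ∈ List (Domino g) ] (IsSaturated g B D × length D ≡ k)

  saturatedOfSize? : ∀ B → Decidable (SaturatedOfSize B)
  saturatedOfSize? B k = map′ fromCandidate toCandidate (Any.any? (saturated? B) (listsOver (dominoesIn B) k))
    where
    fromCandidate : Any (IsSaturated g B) (listsOver (dominoesIn B) k) → SaturatedOfSize B k
    fromCandidate any with find any
    ... | D , D∈ , sat = D , sat , ∈-listsOver⁻ (dominoesIn B) k D∈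
    toCandidate : SaturatedOfSize B k → Any (IsSaturated g B) (listsOver (dominoesIn B) k)
    toCandidate (D , sat , refl) = lose candidate (canonical-saturated sat)
      where
      candidate : map canonical D ∈ listsOver (dominoesIn B) (length D)
      candidate = subst (λ k → map canonical D ∈ listsOver (dominoesIn B) k) (length-map canonical D)
        (∈-listsOver⁺ (All.map⁺ (All.map (λ {d} (a∈B , b∈B) → ∈-dominoesIn d a∈B b∈B) (proj₁ (proj₁ sat)))))

  saturated-size≤ : ∀ {B D} → Unique B → IsSaturated g B D → length D ≤ length B
  saturated-size≤ {D = D} uB sat with saturated⇒starPartition uB sat
  ... | Ss , _ , size = subst (length D ≤_) size (m≤n+m (length D) (length Ss))

  saturated-exists : ∀ {B} → Board g B → ∃ (IsSaturated g B)
  saturated-exists (_ , neighbour) =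
    let D , covering = neighbourCovering neighbour in saturate D (<-wellFounded (length D)) covering

  maximumSaturated : ∀ {B} → Board g B →
                     Σ[ D ∈ List (Domino g) ]
                       (IsSaturated g B D × ∀ {D′} → IsSaturated g B D′ → length D′ ≤ length D)
  maximumSaturated {B} board@(uB , _)
    with greatest-satisfying (saturatedOfSize? B) (length B) (λ { (_ , sat , refl) → saturated-size≤ uB sat })
           (let D , sat = saturated-exists board in length D , D , sat , refl)
  ... | _ , (D , sat , refl) , maximal = D , sat , λ sat′ → maximal (_ , sat′ , refl)

m+n≡o⇒m≡o∸n : ∀ m n {o} → m + n ≡ o → m ≡ o ∸ n
m+n≡o⇒m≡o∸n m n refl = sym (m+n∸n≡m m n)

m+n≡o⇒n≡o∸m : ∀ m n {o} → m + n ≡ o → n ≡ o ∸ m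
m+n≡o⇒n≡o∸m m n refl = sym (m+n∸m≡n m n)

mainTheorem9 : (g : GridKind) (B : List (Cell g)) → Board g B →
    Σ[ d ∈ ℕ ] Σ[ f ∈ ℕ ] (IsD g B d × IsF g B f × d ≡ length B ∸ f)
mainTheorem9 g B board@(uB , _) with Dominoes.maximumSaturated g board
... | D , sat , maximal with Dominoes.saturated⇒tiling g uB sat
... | Fs , tiling , size =
  length D , length Fs , ((D , sat , refl) , λ _ → maximal) , ((Fs , tiling , refl) , fewest) ,
  m+n≡o⇒n≡o∸m (length Fs) (length D) size
  where
  open Dominoes g
  fewest : ∀ Fs′ → IsFragmentTiling g B Fs′ → length Fs ≤ length Fs′
  fewest Fs′ tiling′ with tiling⇒saturated uB tiling′
  ... | D′ , sat′ , size′ = begin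
    length Fs             ≡⟨ m+n≡o⇒m≡o∸n (length Fs) (length D) size ⟩
    length B ∸ length D   ≤⟨ ∸-monoʳ-≤ (length B) (maximal sat′) ⟩
    length B ∸ length D′  ≡⟨ m+n≡o⇒n≡o∸m (length D′) (length Fs′) size′ ⟨
    length Fs′            ∎
    where open ≤-Reasoning
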